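{- Let $\mathcal{H}$ be a hypergraph with $n=|V(\mathcal{H})|$ vertices and let $k\le n$ be an integer. Let $\hat{\mathcal{H}}_{k}=(V(\mathcal{H})\cup\{x\},\ \mathcal{E}(\mathcal{H})\cup\{X\cup\{x\}\mid X\subseteq V(\mathcal{H}),\ |X|=k\})$, where $x$ is a new vertex. Then $Tr(\hat{\mathcal{H}}_{k})=\{T\cup\{x\}\mid T\in Tr(\mathcal{H}),\ |T|<n-k+1\}\cup\mathcal{J}$, where $\mathcal{J}$ consists only of subsets of size at least $n-k+1$.
   Context: A hypergraph $\mathcal{H}=(V(\mathcal{H}),\mathcal{E}(\mathcal{H}))$ has $V(\mathcal{H})$ finite and $\mathcal{E}(\mathcal{H})\subseteq 2^{V(\mathcal{H})}$. A transversal is a vertex set meeting every hyperedge; it is minimal if it contains no other transversal; $Tr(\mathcal{H})$ is the set of minimal transversals. -}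

module Defs where

open import Data.Nat using (ℕ; suc)
open import Data.Bool using (Bool; true; false)
open import Data.Vec using (_∷_)
open import Data.Fin.Subset using (Subset; _∩_; _⊆_; Nonempty; ∣_∣)
open import Data.Product using (_×_)
open import Relation.Binary.PropositionalEquality using (_≡_)

Hypergraph : ℕ → Set₁
Hypergraph n = Subset n → Set

IsTransversal : ∀ {n} → Hypergraph n → Subset n → Set
IsTransversal H T = ∀ E → H E → Nonempty (E ∩ T)

IsMinTransversal : ∀ {n} → Hypergraph n → Subset n → Set
IsMinTransversal H T =
  IsTransversal H T × (∀ T' → T' ⊆ T → IsTransversal H T' → T' ≡ T)

-- Ĥ_k on vertex set Fin (suc n): the new vertex x is `zero` (head of the
-- Bool vector), old vertex i is `suc i`. A subset b ∷ S of Fin (suc n)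
-- contains x iff b = true, and its trace on V(H) is S.
data HatEdge {n : ℕ} (H : Hypergraph n) (k : ℕ) : Subset (suc n) → Set where
  old : ∀ {E} → H E → HatEdge H k (false ∷ E)
  new : ∀ {X} → ∣ X ∣ ≡ k → HatEdge H k (true ∷ X)

Hat : ∀ {n} → Hypergraph n → ℕ → Hypergraph (suc n)
Hat H k = HatEdge H k

-- A transversal of Ĥ_k avoiding x must meet every k-subset of V(H), so its
-- complement has fewer than k vertices and it has more than n − k vertices.
-- Hence a minimal transversal with at most n − k vertices contains x, and its
-- trace T on V(H) is a transversal of H. Adding x to a subset of V(H) hits
-- every new edge, so T ∪ {x} is minimal for Ĥ_k exactly when T is minimal for
-- H: minimality of T leaves T itself as the only smaller candidate, and it
-- avoids x, so |T| ≤ n − k excludes it.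
{-# OPTIONS --safe #-}
module Submission where

open import Defs
open import Data.Nat using (ℕ; zero; suc; _≤_; _<_; _∸_; s≤s; _≤?_)
open import Data.Nat.Properties
  using (<⇒≤; <⇒≱; ≰⇒>; m∸[m∸n]≡n; ∸-monoʳ-≤; module ≤-Reasoning)
open import Data.Bool using (true; false)
open import Data.Vec using (_∷_; here; there)
open import Data.Vec.Properties using (∷-injectiveʳ)
open import Data.Fin using (zero; suc)
open import Data.Fin.Subset using (Subset; ∣_∣; _⊆_; Nonempty; Empty; ∁; ⊥; _∩_)
open import Data.Fin.Subset.Properties
  using (⊥⊆; ∣⊥∣≡0; s⊆s; drop-∷-⊆; ∣∁p∣≡n∸∣p∣; x∈∁p⇒x∉p; x∈p∩q⁻)
open import Data.Product using (Σ; ∃; _×_; _,_; proj₂)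
open import Data.Sum using (_⊎_; inj₁; inj₂)
open import Function.Bundles using (_⇔_; mk⇔)
open import Relation.Nullary using (yes; no; contradiction)
open import Relation.Binary.PropositionalEquality using (_≡_; refl; cong; sym)

CompleteUniform : ∀ {n} → ℕ → Hypergraph n
CompleteUniform k X = ∣ X ∣ ≡ k

Nonempty-∷⁺ : ∀ {n s} {p : Subset n} → Nonempty p → Nonempty (s ∷ p)
Nonempty-∷⁺ (i , i∈p) = suc i , there i∈p

drop-outside∷-Nonempty : ∀ {n} {p : Subset n} → Nonempty (false ∷ p) → Nonempty p
drop-outside∷-Nonempty (suc i , there i∈p) = i , i∈p

∃⊆-of-size : ∀ {n k} (p : Subset n) → k ≤ ∣ p ∣ → ∃ λ q → q ⊆ p × ∣ q ∣ ≡ k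
∃⊆-of-size {n} {zero} p _ = ⊥ , ⊥⊆ , ∣⊥∣≡0 n
∃⊆-of-size {k = suc k} (true ∷ p) (s≤s k≤∣p∣) =
  let q , q⊆p , ∣q∣≡k = ∃⊆-of-size p k≤∣p∣ in true ∷ q , s⊆s q⊆p , cong suc ∣q∣≡k
∃⊆-of-size {k = suc k} (false ∷ p) k<∣p∣ =
  let q , q⊆p , ∣q∣≡k = ∃⊆-of-size p k<∣p∣ in false ∷ q , s⊆s q⊆p , ∣q∣≡k

⊆∁⇒disjoint : ∀ {n} {p q : Subset n} → p ⊆ ∁ q → Empty (p ∩ q)
⊆∁⇒disjoint {p = p} {q} p⊆∁q (i , i∈p∩q) =
  let i∈p , i∈q = x∈p∩q⁻ p q i∈p∩q in x∈∁p⇒x∉p (p⊆∁q i∈p) i∈q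

CompleteUniform-transversal⇒large : ∀ {n k} {T : Subset n} → k ≤ n →
  IsTransversal (CompleteUniform k) T → n ∸ k < ∣ T ∣
CompleteUniform-transversal⇒large {n} {k} {T} k≤n τ with ∣ T ∣ ≤? n ∸ k
... | no ∣T∣≰n∸k = ≰⇒> ∣T∣≰n∸k
... | yes ∣T∣≤n∸k =
  let X , X⊆∁T , ∣X∣≡k = ∃⊆-of-size (∁ T) k≤∣∁T∣
  in contradiction (τ X ∣X∣≡k) (⊆∁⇒disjoint X⊆∁T)
  where
  open ≤-Reasoning
  k≤∣∁T∣ : k ≤ ∣ ∁ T ∣
  k≤∣∁T∣ = begin
    k             ≡⟨ sym (m∸[m∸n]≡n k≤n) ⟩
    n ∸ (n ∸ k)   ≤⟨ ∸-monoʳ-≤ n ∣T∣≤n∸k ⟩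
    n ∸ ∣ T ∣     ≡⟨ sym (∣∁p∣≡n∸∣p∣ T) ⟩
    ∣ ∁ T ∣       ∎

module _ {n : ℕ} {H : Hypergraph n} {k : ℕ} where

  Hat-transversal⇒transversal : ∀ {b T} →
    IsTransversal (Hat H k) (b ∷ T) → IsTransversal H T
  Hat-transversal⇒transversal τ E E∈H = drop-outside∷-Nonempty (τ (false ∷ E) (old E∈H))

  Hat-transversal⇒CompleteUniform-transversal : ∀ {T} →
    IsTransversal (Hat H k) (false ∷ T) → IsTransversal (CompleteUniform k) T
  Hat-transversal⇒CompleteUniform-transversal τ X ∣X∣≡k =
    drop-outside∷-Nonempty (τ (true ∷ X) (new ∣X∣≡k))

  transversal⇒Hat-transversal : ∀ {T} →
    IsTransversal H T → IsTransversal (Hat H k) (true ∷ T)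
  transversal⇒Hat-transversal τ _ (old {E} E∈H) = Nonempty-∷⁺ (τ E E∈H)
  transversal⇒Hat-transversal τ _ (new _)        = zero , here

  Hat-transversal-without-x⇒large : ∀ {T} → k ≤ n →
    IsTransversal (Hat H k) (false ∷ T) → n ∸ k < ∣ T ∣
  Hat-transversal-without-x⇒large k≤n τ =
    CompleteUniform-transversal⇒large k≤n (Hat-transversal⇒CompleteUniform-transversal τ)

  Hat-min-transversal⇒min-transversal : ∀ {T} →
    IsMinTransversal (Hat H k) (true ∷ T) → IsMinTransversal H T
  Hat-min-transversal⇒min-transversal (τ , minimal) =
    Hat-transversal⇒transversal τ ,
    λ U U⊆T υ → ∷-injectiveʳ (minimal (true ∷ U) (s⊆s U⊆T) (transversal⇒Hat-transversal υ))

  min-transversal⇒Hat-min-transversal : ∀ {T} → k ≤ n → ∣ T ∣ ≤ n ∸ k →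
    IsMinTransversal H T → IsMinTransversal (Hat H k) (true ∷ T)
  min-transversal⇒Hat-min-transversal {T} k≤n ∣T∣≤n∸k (τ , minimal) =
    transversal⇒Hat-transversal τ , minimal-Hat
    where
    minimal-Hat : ∀ S → S ⊆ true ∷ T → IsTransversal (Hat H k) S → S ≡ true ∷ T
    minimal-Hat (b ∷ U) S⊆xT σ
      with minimal U (drop-∷-⊆ S⊆xT) (Hat-transversal⇒transversal σ)
    minimal-Hat (true ∷ _)  _ _ | refl = refl
    minimal-Hat (false ∷ _) _ σ | refl =
      contradiction ∣T∣≤n∸k (<⇒≱ (Hat-transversal-without-x⇒large k≤n σ))

proposition5 : (n : ℕ) (H : Hypergraph n) (k : ℕ) → k ≤ n →
    Σ (Subset (suc n) → Set) λ J →
      (∀ S → J S → suc (n ∸ k) ≤ ∣ S ∣) ×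
      (∀ S → IsMinTransversal (Hat H k) S ⇔
        ((∃ λ T → IsMinTransversal H T × ∣ T ∣ < suc (n ∸ k) × S ≡ true ∷ T) ⊎ J S))
proposition5 n H k k≤n = J , (λ _ → proj₂) , λ S → mk⇔ (classify S) (unclassify S)
  where
  J : Subset (suc n) → Set
  J S = IsMinTransversal (Hat H k) S × suc (n ∸ k) ≤ ∣ S ∣

  Small : Subset (suc n) → Set
  Small S = ∃ λ T → IsMinTransversal H T × ∣ T ∣ < suc (n ∸ k) × S ≡ true ∷ T

  classify : ∀ S → IsMinTransversal (Hat H k) S → Small S ⊎ J S
  classify S μ with suc (n ∸ k) ≤? ∣ S ∣
  ... | yes large = inj₂ (μ , large)
  classify (false ∷ T) (τ , _) | no small =
    contradiction (Hat-transversal-without-x⇒large k≤n τ) small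
  classify (true ∷ T) μ | no small =
    inj₁ (T , Hat-min-transversal⇒min-transversal μ , <⇒≤ (≰⇒> small) , refl)

  unclassify : ∀ S → Small S ⊎ J S → IsMinTransversal (Hat H k) S
  unclassify _ (inj₁ (T , μ , s≤s ∣T∣≤n∸k , refl)) =
    min-transversal⇒Hat-min-transversal k≤n ∣T∣≤n∸k μ
  unclassify _ (inj₂ (μ , _)) = μ
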